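{- Let $\lambda,k\geq 1$ and $c_{\lambda,k}\geq 0$. Suppose $\mathcal{A}$ is an algorithm that, given any directed graph $G$ with designated source $s$ and any vertex $v\in V(G)$, computes a $(\lambda,k)$-FT-BFP of $G$ in which $v$ has at most $c_{\lambda,k}$ in-edges. Then, using $\mathcal{A}$, one can construct for any $n$-vertex directed graph with a designated source a $(\lambda,k)$-FT-BFP with at most $c_{\lambda,k}\cdot n$ edges.
   Context: Edges have unit capacity; $\textsc{max-flow}(s,t,G)$ is the maximum number of edge-disjoint $s$-to-$t$ paths and $G\setminus F$ is $G$ with the edges of $F$ deleted. A $(\lambda,k)$-FT-BFP of a directed graph $G=(V,E)$ with source $s$ is a subgraph $H=(V,E_H)$, $E_H\subseteq E$, such that for every $F\subseteq E$ with $|F|\leq k$ and every $t\in V$: if $\textsc{max-flow}(s,t,G\setminus F)\leq\lambda$ then $\textsc{max-flow}(s,t,H\setminus F)=\textsc{max-flow}(s,t,G\setminus F)$, and otherwise $\textsc{max-flow}(s,t,H\setminus F)\geq\lambda$. -}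

module Defs where

open import Data.Nat using (ℕ; _≤_; _<_)
open import Data.Fin using (Fin; _≟_)
open import Data.Fin.Subset using (Subset; _∈_; _∩_; ∁; ∣_∣)
open import Data.List using (List; []; _∷_; concat)
open import Data.Vec using (Vec; toList; tabulate)
open import Data.Vec.Relation.Unary.All using (All)
open import Data.List.Relation.Unary.Unique.Propositional using (Unique)
open import Data.Product using (Σ; _×_)
open import Relation.Nullary using (¬_; does)
open import Relation.Binary.PropositionalEquality using (_≡_)

record Graph (n : ℕ) : Set where
  field
    m   : ℕ
    src : Fin m → Fin n
    tgt : Fin m → Fin n
open Graph public

EdgeSet : ∀ {n} → Graph n → Set
EdgeSet G = Subset (m G)

data Walk {n} (G : Graph n) (S : EdgeSet G) : Fin n → Fin n → List (Fin (m G)) → Set where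
  [] : ∀ {u} → Walk G S u u []
  step : ∀ {u w e es} → e ∈ S → src G e ≡ u → Walk G S (tgt G e) w es → Walk G S u w (e ∷ es)

HasFlow : ∀ {n} (G : Graph n) → EdgeSet G → Fin n → Fin n → ℕ → Set
HasFlow G S s t r =
  Σ (Vec (List (Fin (m G))) r) λ ps → All (Walk G S s t) ps × Unique (concat (toList ps))

MaxFlow : ∀ {n} (G : Graph n) → EdgeSet G → Fin n → Fin n → ℕ → Set
MaxFlow G S s t f = HasFlow G S s t f × ¬ HasFlow G S s t (ℕ.suc f)

-- H is a (lam,k)-FT-BFP of G with source s.
-- G \ F has edge set ∁ F; H \ F has edge set H ∩ ∁ F.
IsFTBFP : ∀ {n} (G : Graph n) (s : Fin n) (lam k : ℕ) (H : EdgeSet G) → Set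
IsFTBFP {n} G s lam k H =
  ∀ (F : EdgeSet G) → ∣ F ∣ ≤ k → ∀ (t : Fin n) (f : ℕ) → MaxFlow G (∁ F) s t f →
    (f ≤ lam → MaxFlow G (H ∩ ∁ F) s t f) × (lam < f → HasFlow G (H ∩ ∁ F) s t lam)

InEdges : ∀ {n} (G : Graph n) → Fin n → EdgeSet G
InEdges G v = tabulate λ e → does (tgt G e ≟ v)

inDeg : ∀ {n} (G : Graph n) → EdgeSet G → Fin n → ℕ
inDeg G H v = ∣ H ∩ InEdges G v ∣

-- Start from H = E and treat the vertices one at a time: for the vertex v,
-- run the algorithm on the subgraph H (seen as a graph on the same edge
-- indices) with v as the designated vertex, and intersect H with its output.
-- An FT-BFP of an FT-BFP of G is an FT-BFP of G, later steps only shrink H,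
-- so at the end every vertex has at most c in-edges and |H| = Σ_v indeg(v) ≤ c·n.
-- Transitivity uses the guarantee of the inner FT-BFP at the exact max-flow
-- value of H ∖ F, which exists constructively because max-flow is decidable.

module Submission where

open import Defs
open import Data.Bool using (true; false; if_then_else_)
open import Data.Fin using (Fin; zero; suc; _≟_)
open import Data.Fin.Properties using (any?; injective⇒≤)
open import Data.Fin.Subset using (Subset; _∩_; ∁; ∣_∣; ⊤; _⊆_; inside; outside) renaming (_∈_ to _∈ₛ_)
open import Data.Fin.Subset.Properties using (_∈?_; x∈p∩q⁺; x∈p∩q⁻; p∩q⊆p; p∩q⊆q; p⊆q⇒∣p∣≤∣q∣; ∩-assoc; ∩-identityˡ)
open import Data.List using (List; []; _∷_; _++_; concat; length; lookup; allFin)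
open import Data.List.Properties using (++-assoc)
open import Data.List.Membership.Propositional using (_∈_)
open import Data.List.Membership.Propositional.Properties using (∈-lookup; ∈-allFin)
open import Data.List.Relation.Binary.Sublist.Propositional using ([]; _∷_; _∷ʳ_; ⊆-refl) renaming (_⊆_ to _⊑_)
open import Data.List.Relation.Binary.Sublist.Propositional.Properties using (All-resp-⊆; ++⁺; ++⁺ˡ; ++⁺ʳ)
import Data.List.Relation.Unary.All as List
open import Data.List.Relation.Unary.AllPairs using ([]; _∷_)
open import Data.List.Relation.Unary.Any using (here; there)
open import Data.List.Relation.Unary.Unique.Propositional using (Unique)
open import Data.List.Relation.Unary.Unique.DecPropositional using (unique?)
open import Data.Nat using (ℕ; zero; suc; _≤_; _<_; _≤′_; ≤′-refl; ≤′-step; _*_; _+_; z≤n; s≤s)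
open import Data.Nat.Properties using (module ≤-Reasoning; +-0-monoid; ≤-refl; ≤-trans; <⇒≤; +-mono-≤; +-suc; *-comm; ≤⇒≤′; m≤n⇒m<n∨m≡n)
open import Algebra.Properties.Monoid.Sum +-0-monoid using (sum-syntax; sum-replicate-zero)
open import Data.Product using (Σ; ∃-syntax; _×_; _,_; proj₁; proj₂)
open import Data.Sum using (_⊎_; inj₁; inj₂)
open import Data.Vec using (Vec; []; _∷_; toList)
open import Data.Vec.Properties using (lookup⇒[]=; []=⇒lookup; lookup∘tabulate)
import Data.Vec as Vec
open import Data.Vec.Relation.Unary.All using (All; []; _∷_)
import Data.Vec.Relation.Unary.All as VecAll
open import Function using (_∘_; _⇔_; mk⇔; Injective)
open import Function.Bundles using (Equivalence)
open import Relation.Binary.PropositionalEquality using (_≡_; refl; sym; trans; subst; cong)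
open import Relation.Nullary using (¬_; Dec; yes; no; does; contradiction)
open import Relation.Nullary.Decidable using (dec-true; map′; _×-dec_; _⊎-dec_)
open import Relation.Unary using (Decidable)

private variable
  A : Set
  n : ℕ

Unique-resp-⊑ : {xs ys : List A} → xs ⊑ ys → Unique ys → Unique xs
Unique-resp-⊑ []         []          = []
Unique-resp-⊑ (y ∷ʳ τ)   (_ ∷ u)     = Unique-resp-⊑ τ u
Unique-resp-⊑ (refl ∷ τ) (x∉ys ∷ u) = All-resp-⊆ τ x∉ys ∷ Unique-resp-⊑ τ u

Unique⇒lookup-injective : {xs : List A} → Unique xs → Injective _≡_ _≡_ (lookup xs)
Unique⇒lookup-injective (_ ∷ _)    {zero}  {zero}  _  = refl
Unique⇒lookup-injective (x∉xs ∷ _) {zero}  {suc j} eq = contradiction eq (List.lookup x∉xs (∈-lookup j))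
Unique⇒lookup-injective (x∉xs ∷ _) {suc i} {zero}  eq = contradiction (sym eq) (List.lookup x∉xs (∈-lookup i))
Unique⇒lookup-injective (_ ∷ u)    {suc i} {suc j} eq = cong suc (Unique⇒lookup-injective u eq)

Unique⇒length≤ : ∀ {m} {xs : List (Fin m)} → Unique xs → length xs ≤ m
Unique⇒length≤ u = injective⇒≤ (Unique⇒lookup-injective u)

∃-length≤? : ∀ {m} {P : List (Fin m) → Set} → Decidable P → (L : ℕ) → Dec (∃[ xs ] length xs ≤ L × P xs)
∃-length≤? P? zero = map′ (λ p → [] , z≤n , p) (λ { ([] , _ , p) → p }) (P? [])
∃-length≤? {P = P} P? (suc L) = map′ to from (P? [] ⊎-dec any? (λ i → ∃-length≤? (P? ∘ (i ∷_)) L))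
  where
  to : P [] ⊎ ∃[ i ] ∃[ xs ] length xs ≤ L × P (i ∷ xs) → ∃[ xs ] length xs ≤ suc L × P xs
  to (inj₁ p)                = [] , z≤n , p
  to (inj₂ (i , xs , le , p)) = i ∷ xs , s≤s le , p
  from : ∃[ xs ] length xs ≤ suc L × P xs → P [] ⊎ ∃[ i ] ∃[ xs ] length xs ≤ L × P (i ∷ xs)
  from ([]     , _       , p) = inj₁ p
  from (i ∷ xs , s≤s le , p) = inj₂ (i , xs , le , p)

module _ {P : ℕ → Set} (P? : Decidable P) where

  ∃-maximal : ∀ {a} → P a → ∀ b → a ≤ b → ¬ P (suc b) → ∃[ g ] a ≤ g × P g × ¬ P (suc g)
  ∃-maximal pa b a≤b ¬Psb with P? b
  ... | yes pb = b , a≤b , pb , ¬Psb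
  ... | no ¬pb with m≤n⇒m<n∨m≡n a≤b
  ...   | inj₂ refl           = contradiction pa ¬pb
  ...   | inj₁ (s≤s a≤b-1)   = ∃-maximal pa _ a≤b-1 ¬pb

module _ (G : Graph n) where

  Walk-mono : {S T : EdgeSet G} → S ⊆ T → ∀ {u w es} → Walk G S u w es → Walk G T u w es
  Walk-mono S⊆T []                = []
  Walk-mono S⊆T (step e∈S src≡u w) = step (S⊆T e∈S) src≡u (Walk-mono S⊆T w)

  HasFlow-mono : {S T : EdgeSet G} → S ⊆ T → ∀ {s t r} → HasFlow G S s t r → HasFlow G T s t r
  HasFlow-mono S⊆T (ps , ws , u) = ps , VecAll.map (Walk-mono S⊆T) ws , u

  HasFlow-≤ : ∀ {S s t r r′} → r ≤ r′ → HasFlow G S s t r′ → HasFlow G S s t r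
  HasFlow-≤ = go ∘ ≤⇒≤′
    where
    go : ∀ {S s t r r′} → r ≤′ r′ → HasFlow G S s t r′ → HasFlow G S s t r
    go ≤′-refl        h                     = h
    go (≤′-step r≤′r′) (p ∷ ps , _ ∷ ws , u) = go r≤′r′ (ps , ws , Unique-resp-⊑ (++⁺ˡ p ⊆-refl) u)

  walk? : (S : EdgeSet G) (u w : Fin n) (es : List (Fin (m G))) → Dec (Walk G S u w es)
  walk? S u w []       = map′ (λ { refl → [] }) (λ { [] → refl }) (u ≟ w)
  walk? S u w (e ∷ es) = map′ (λ (e∈S , src≡u , rest) → step e∈S src≡u rest)
                              (λ { (step e∈S src≡u rest) → e∈S , src≡u , rest })
                              (e ∈? S ×-dec src G e ≟ u ×-dec walk? S (tgt G e) w es)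

  module _ (S : EdgeSet G) (s t : Fin n) where

    HasFlowAvoiding : List (Fin (m G)) → ℕ → Set
    HasFlowAvoiding used r =
      Σ (Vec (List (Fin (m G))) r) λ ps → All (Walk G S s t) ps × Unique (used ++ concat (toList ps))

    hasFlowAvoiding? : ∀ used r → Dec (HasFlowAvoiding used r)
    hasFlowAvoiding? used zero = map′ (λ u → [] , [] , u) (λ { ([] , [] , u) → u }) (unique? _≟_ (used ++ []))
    -- The paths of a flow have pairwise distinct edges, so none is longer than m G.
    hasFlowAvoiding? used (suc r) =
      map′ to from (∃-length≤? (λ p → walk? S s t p ×-dec hasFlowAvoiding? (used ++ p) r) (m G))
      where
      to : ∃[ p ] length p ≤ m G × Walk G S s t p × HasFlowAvoiding (used ++ p) r → HasFlowAvoiding used (suc r)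
      to (p , _ , w , ps , ws , u) = p ∷ ps , w ∷ ws , subst Unique (++-assoc used p _) u
      from : HasFlowAvoiding used (suc r) → ∃[ p ] length p ≤ m G × Walk G S s t p × HasFlowAvoiding (used ++ p) r
      from (p ∷ ps , w ∷ ws , u) = p , Unique⇒length≤ (Unique-resp-⊑ p⊑ u) , w , ps , ws , u′
        where
        p⊑ : p ⊑ used ++ (p ++ concat (toList ps))
        p⊑ = ++⁺ˡ used (++⁺ʳ (concat (toList ps)) ⊆-refl)
        u′ : Unique ((used ++ p) ++ concat (toList ps))
        u′ = subst Unique (sym (++-assoc used p _)) u

    hasFlow? : ∀ r → Dec (HasFlow G S s t r)
    hasFlow? = hasFlowAvoiding? []

∈InEdges⇔ : (G : Graph n) {e : Fin (m G)} {v : Fin n} → e ∈ₛ InEdges G v ⇔ tgt G e ≡ v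
∈InEdges⇔ G {e} {v} = mk⇔ to from
  where
  lookup-InEdges : Vec.lookup (InEdges G v) e ≡ does (tgt G e ≟ v)
  lookup-InEdges = lookup∘tabulate (λ i → does (tgt G i ≟ v)) e
  to : e ∈ₛ InEdges G v → tgt G e ≡ v
  to e∈ with tgt G e ≟ v | trans (sym lookup-InEdges) ([]=⇒lookup e∈)
  ... | yes tgt≡v | _ = tgt≡v
  ... | no _      | ()
  from : tgt G e ≡ v → e ∈ₛ InEdges G v
  from tgt≡v = lookup⇒[]= e (InEdges G v) (trans lookup-InEdges (dec-true (tgt G e ≟ v) tgt≡v))

-- Edges outside H become loops at their source: the edge indices, hence the
-- fault sets, are shared with G, and a loop can always be cut out of a walk.
restrict : (G : Graph n) → EdgeSet G → Graph n
restrict G H = record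
  { m   = m G
  ; src = src G
  ; tgt = λ e → if Vec.lookup H e then tgt G e else src G e
  }

module _ (G : Graph n) (H : EdgeSet G) where

  private
    G[H] = restrict G H

  tgt-restrict : ∀ {e} → e ∈ₛ H → tgt G[H] e ≡ tgt G e
  tgt-restrict {e} e∈H rewrite []=⇒lookup e∈H = refl

  Walk-restrict⁻ : ∀ {S u w es} → Walk G[H] S u w es → ∃[ es′ ] es′ ⊑ es × Walk G (H ∩ S) u w es′
  Walk-restrict⁻ [] = [] , [] , []
  Walk-restrict⁻ (step {e = e} e∈S src≡u rest) with Vec.lookup H e in e∈H | Walk-restrict⁻ rest
  ... | true  | es′ , τ , w = e ∷ es′ , refl ∷ τ , step (x∈p∩q⁺ (lookup⇒[]= e H e∈H , e∈S)) src≡u w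
  ... | false | es′ , τ , w = es′ , e ∷ʳ τ , subst (λ x → Walk G _ x _ es′) src≡u w

  Walk-restrict⁺ : ∀ {T u w es} → T ⊆ H → Walk G T u w es → Walk G[H] T u w es
  Walk-restrict⁺ T⊆H [] = []
  Walk-restrict⁺ T⊆H (step e∈T src≡u rest) =
    step e∈T src≡u (subst (λ x → Walk G[H] _ x _ _) (sym (tgt-restrict (T⊆H e∈T))) (Walk-restrict⁺ T⊆H rest))

  HasFlow-restrict : ∀ {S s t r} → HasFlow G[H] S s t r ⇔ HasFlow G (H ∩ S) s t r
  HasFlow-restrict {S} {s} {t} = mk⇔ to from
    where
    Walks⁻ : ∀ {r} → (ps : Vec (List (Fin (m G))) r) → All (Walk G[H] S s t) ps →
      ∃[ qs ] All (Walk G (H ∩ S) s t) qs × concat (toList qs) ⊑ concat (toList ps)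
    Walks⁻ []       []       = [] , [] , []
    Walks⁻ (p ∷ ps) (w ∷ ws) with Walk-restrict⁻ w | Walks⁻ ps ws
    ... | q , τ , w′ | qs , ws′ , σ = q ∷ qs , w′ ∷ ws′ , ++⁺ τ σ
    to : ∀ {r} → HasFlow G[H] S s t r → HasFlow G (H ∩ S) s t r
    to (ps , ws , u) with Walks⁻ ps ws
    ... | qs , ws′ , σ = qs , ws′ , Unique-resp-⊑ σ u
    from : ∀ {r} → HasFlow G (H ∩ S) s t r → HasFlow G[H] S s t r
    from (ps , ws , u) = HasFlow-mono G[H] (p∩q⊆q H S) (ps , VecAll.map (Walk-restrict⁺ (p∩q⊆p H S)) ws , u)

  inDeg-restrict : ∀ H′ v → inDeg G (H ∩ H′) v ≤ inDeg G[H] H′ v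
  inDeg-restrict H′ v = p⊆q⇒∣p∣≤∣q∣ λ {e} e∈ →
    let e∈H∩H′ , e∈In = x∈p∩q⁻ (H ∩ H′) (InEdges G v) e∈
        e∈H , e∈H′ = x∈p∩q⁻ H H′ e∈H∩H′
        tgt≡v = trans (tgt-restrict e∈H) (Equivalence.to (∈InEdges⇔ G) e∈In)
    in x∈p∩q⁺ (e∈H′ , Equivalence.from (∈InEdges⇔ G[H]) tgt≡v)

  MaxFlow-restrict : ∀ {S s t f} → MaxFlow G[H] S s t f ⇔ MaxFlow G (H ∩ S) s t f
  MaxFlow-restrict = mk⇔ (λ (h , ¬h′) → to HasFlow-restrict h , ¬h′ ∘ from HasFlow-restrict)
                         (λ (h , ¬h′) → from HasFlow-restrict h , ¬h′ ∘ to HasFlow-restrict)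
    where open Equivalence

module _ {lam k : ℕ} where

  IsFTBFP-⊤ : {G : Graph n} {s : Fin n} → IsFTBFP G s lam k ⊤
  IsFTBFP-⊤ {G = G} F _ t f mf rewrite ∩-identityˡ (∁ F) =
    (λ _ → mf) , (λ lam<f → HasFlow-≤ G (<⇒≤ lam<f) (proj₁ mf))

  IsFTBFP⇒HasFlow-lam : ∀ {G : Graph n} {s H} → IsFTBFP G s lam k H →
    ∀ {F} → ∣ F ∣ ≤ k → ∀ {t g} → MaxFlow G (∁ F) s t g → lam ≤ g → HasFlow G (H ∩ ∁ F) s t lam
  IsFTBFP⇒HasFlow-lam isH {F} |F|≤k {t} {g} mf lam≤g with m≤n⇒m<n∨m≡n lam≤g
  ... | inj₁ lam<g = proj₂ (isH F |F|≤k t g mf) lam<g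
  ... | inj₂ refl  = proj₁ (proj₁ (isH F |F|≤k t g mf) ≤-refl)

  IsFTBFP-restrict : ∀ {G : Graph n} {s H H′} →
    IsFTBFP G s lam k H → IsFTBFP (restrict G H) s lam k H′ → IsFTBFP G s lam k (H ∩ H′)
  IsFTBFP-restrict {G = G} {s} {H} {H′} isH isH′ F |F|≤k t f mf rewrite ∩-assoc H H′ (∁ F) = exact , atLeast
    where
    open Equivalence
    G[H] = restrict G H
    exact : f ≤ lam → MaxFlow G (H ∩ (H′ ∩ ∁ F)) s t f
    exact f≤lam = to (MaxFlow-restrict G H) (proj₁ (isH′ F |F|≤k t f mf′) f≤lam)
      where
      mf′ = from (MaxFlow-restrict G H) (proj₁ (isH F |F|≤k t f mf) f≤lam)
    -- H′ is informative only at the exact max-flow value of G[H] ∖ F, which lies in [lam, f].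
    atLeast : lam < f → HasFlow G (H ∩ (H′ ∩ ∁ F)) s t lam
    atLeast lam<f with ∃-maximal (hasFlow? G[H] (∁ F) s t) lam-flow f (<⇒≤ lam<f) no-flow-above-f
      where
      lam-flow = from (HasFlow-restrict G H) (proj₂ (isH F |F|≤k t f mf) lam<f)
      no-flow-above-f : ¬ HasFlow G[H] (∁ F) s t (suc f)
      no-flow-above-f = proj₂ mf ∘ HasFlow-mono G (p∩q⊆q H (∁ F)) ∘ to (HasFlow-restrict G H)
    ... | g , lam≤g , mfg = to (HasFlow-restrict G H) (IsFTBFP⇒HasFlow-lam isH′ |F|≤k mfg lam≤g)

inDeg-mono : (G : Graph n) {H H′ : EdgeSet G} → H ⊆ H′ → ∀ v → inDeg G H v ≤ inDeg G H′ v
inDeg-mono G {H} H⊆H′ v = p⊆q⇒∣p∣≤∣q∣ λ e∈ →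
  let e∈H , e∈In = x∈p∩q⁻ H (InEdges G v) e∈ in x∈p∩q⁺ (H⊆H′ e∈H , e∈In)

∑-∣does∷∣ : ∀ {m} (x : Fin n) (q : Fin n → Subset m) →
  ∑[ v < n ] ∣ does (x ≟ v) ∷ q v ∣ ≡ suc (∑[ v < n ] ∣ q v ∣)
∑-∣does∷∣ zero    q = refl
∑-∣does∷∣ (suc x) q = trans (cong (∣ q zero ∣ +_) (∑-∣does∷∣ x (q ∘ suc))) (+-suc _ _)

∣p∣≡∑∣p∩fibre∣ : ∀ {m} (p : Subset m) (f : Fin m → Fin n) →
  ∣ p ∣ ≡ ∑[ v < n ] ∣ p ∩ Vec.tabulate (λ e → does (f e ≟ v)) ∣
∣p∣≡∑∣p∩fibre∣ {n} []            f = sym (sum-replicate-zero n)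
∣p∣≡∑∣p∩fibre∣     (outside ∷ p) f = ∣p∣≡∑∣p∩fibre∣ p (f ∘ suc)
∣p∣≡∑∣p∩fibre∣     (inside ∷ p)  f =
  trans (cong suc (∣p∣≡∑∣p∩fibre∣ p (f ∘ suc))) (sym (∑-∣does∷∣ (f zero) p∩fibre))
  where
  p∩fibre : Fin _ → Subset _
  p∩fibre v = p ∩ Vec.tabulate (λ e → does (f (suc e) ≟ v))

∣H∣≡∑inDeg : (G : Graph n) (H : EdgeSet G) → ∣ H ∣ ≡ ∑[ v < n ] inDeg G H v
∣H∣≡∑inDeg G H = ∣p∣≡∑∣p∩fibre∣ H (tgt G)

∑≤n*c : ∀ {c} (f : Fin n → ℕ) → (∀ i → f i ≤ c) → ∑[ i < n ] f i ≤ n * c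
∑≤n*c {zero}  f f≤c = z≤n
∑≤n*c {suc n} f f≤c = +-mono-≤ (f≤c zero) (∑≤n*c (f ∘ suc) (f≤c ∘ suc))

BoundedInDegreeFTBFPs : (lam k c : ℕ) → Set
BoundedInDegreeFTBFPs lam k c =
  (n : ℕ) (G : Graph n) (s v : Fin n) → Σ (EdgeSet G) λ H → IsFTBFP G s lam k H × inDeg G H v ≤ c

module _ {lam k c : ℕ} (𝒜 : BoundedInDegreeFTBFPs lam k c) (G : Graph n) (s : Fin n) where

  sparsify : (vs : List (Fin n)) →
    Σ (EdgeSet G) λ H → IsFTBFP G s lam k H × (∀ {v} → v ∈ vs → inDeg G H v ≤ c)
  sparsify [] = ⊤ , IsFTBFP-⊤ , λ ()
  sparsify (v ∷ vs) with sparsify vs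
  ... | H , isH , deg with 𝒜 _ (restrict G H) s v
  ... | H′ , isH′ , deg′ = H ∩ H′ , IsFTBFP-restrict isH isH′ , deg″
    where
    deg″ : ∀ {w} → w ∈ v ∷ vs → inDeg G (H ∩ H′) w ≤ c
    deg″ (here refl)  = ≤-trans (inDeg-restrict G H H′ v) deg′
    deg″ (there w∈vs) = ≤-trans (inDeg-mono G (p∩q⊆p H H′) _) (deg w∈vs)

lemma5 : (lam k c : ℕ) → 1 ≤ lam → 1 ≤ k →
    ((n : ℕ) (G : Graph n) (s v : Fin n) →
      Σ (EdgeSet G) λ H → IsFTBFP G s lam k H × inDeg G H v ≤ c) →
    (n : ℕ) (G : Graph n) (s : Fin n) →
      Σ (EdgeSet G) λ H → IsFTBFP G s lam k H × ∣ H ∣ ≤ c * n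
lemma5 lam k c _ _ 𝒜 n G s with sparsify 𝒜 G s (allFin n)
... | H , isH , deg = H , isH , ∣H∣≤c*n
  where
  open ≤-Reasoning
  ∣H∣≤c*n : ∣ H ∣ ≤ c * n
  ∣H∣≤c*n = begin
    ∣ H ∣                   ≡⟨ ∣H∣≡∑inDeg G H ⟩
    ∑[ v < n ] inDeg G H v  ≤⟨ ∑≤n*c (inDeg G H) (λ v → deg (∈-allFin v)) ⟩
    n * c                   ≡⟨ *-comm n c ⟩
    c * n                   ∎
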